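{- Let $G$ be a simple connected graph and let $W'\subseteq V(G)$ with $|W'|\ge 2$. If $d(x,y)\le 2$ for every pair of vertices $x,y\in W'$, then $W'$ is not an m-resolving set of $G$.
   Context: For vertices $u,v$ of a connected graph $G$, $d(u,v)$ is the length of a shortest $u$–$v$ path. For $W\subseteq V(G)$ and $v\in V(G)$, $r_m(v|W)$ is the multiset $\{d(v,w): w\in W\}$. $W$ is an m-resolving set if $r_m(u|W)\neq r_m(v|W)$ for all distinct $u,v\in V(G)$. -}

module Defs where

open import Data.Nat using (ℕ; zero; suc; _≤_)
open import Data.Fin using (Fin)
open import Data.List using (List; map)
open import Data.Product using (∃; _×_)
open import Relation.Nullary using (¬_)
open import Relation.Binary.PropositionalEquality using (_≡_; _≢_)
open import Data.List.Relation.Binary.Permutation.Propositional using (_↭_)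

record SimpleGraph (n : ℕ) : Set₁ where
  field
    Adj     : Fin n → Fin n → Set
    sym     : ∀ {u v} → Adj u v → Adj v u
    irrefl  : ∀ {u} → ¬ Adj u u

open SimpleGraph public

data Walk {n : ℕ} (G : SimpleGraph n) : Fin n → Fin n → ℕ → Set where
  stay : ∀ {u} → Walk G u u zero
  step : ∀ {u w v k} → Adj G u w → Walk G w v k → Walk G u v (suc k)

Connected : ∀ {n} → SimpleGraph n → Set
Connected G = ∀ u v → ∃ λ k → Walk G u v k

IsDistance : ∀ {n} → SimpleGraph n → Fin n → Fin n → ℕ → Set
IsDistance G u v k = Walk G u v k × (∀ m → Walk G u v m → k ≤ m)

IsDistanceFn : ∀ {n} → SimpleGraph n → (Fin n → Fin n → ℕ) → Set
IsDistanceFn G d = ∀ u v → IsDistance G u v (d u v)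

-- multiset representation r_m(v|W), as a list of distances up to permutation
rm : ∀ {n} → (Fin n → Fin n → ℕ) → Fin n → List (Fin n) → List ℕ
rm d v W = map (d v) W

MResolving : ∀ {n} → (Fin n → Fin n → ℕ) → List (Fin n) → Set
MResolving d W = ∀ u v → u ≢ v → ¬ (rm d u W ↭ rm d v W)

-- Let |W| = m + 1.  For x ∈ W the multiset r_m(x|W) contains exactly one 0
-- (from x itself) and otherwise only 1s and 2s, so it is determined by the
-- number of 1s, the W-degree of x, which lies in {0, …, m}.  The values 0 and
-- m cannot both occur: a vertex of W-degree m is adjacent to every other
-- vertex of W, in particular to a vertex of W-degree 0.  So m + 1 vertices
-- take at most m degree values, and by pigeonhole two distinct vertices have
-- the same W-degree, hence the same multiset representation.
module Submission where

open import Defs hiding (sym)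
open import Data.Nat using (ℕ; _≤_)
open import Data.Fin using (Fin)
open import Data.List using (List; length)
open import Data.List.Relation.Unary.Unique.Propositional using (Unique)
open import Data.List.Membership.Propositional using (_∈_)
open import Relation.Nullary using (¬_)

open import Data.Nat using (suc; _+_; _∸_; _<_; z≤n; s≤s; s≤s⁻¹; z<s)
open import Data.Nat.Properties
open import Data.Fin using (toℕ; fromℕ<)
import Data.Fin as F
import Data.Fin.Properties as FinP
open import Data.List using ([]; _∷_; _++_; map; lookup)
open import Data.List.Relation.Unary.All as All using (All)
import Data.List.Relation.Unary.All.Properties as AllP
open import Data.List.Relation.Unary.AllPairs using ([]; _∷_)
open import Data.List.Relation.Unary.Any using (here; there)
open import Data.List.Membership.Propositional using (_∉_)
open import Data.List.Membership.Propositional.Properties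
  using (∈-map⁺; ∈-map⁻; ∈-lookup; ∈-∃++)
open import Data.List.Properties using (length-map)
open import Data.List.Relation.Binary.Permutation.Propositional
  using (_↭_; prep; swap; ↭-sym) renaming (refl to ↭-refl; trans to ↭-trans)
open import Data.List.Relation.Binary.Permutation.Propositional.Properties
  using (shift)
open import Data.Product using (_×_; _,_; proj₁; proj₂; ∃₂)
open import Relation.Nullary using (Dec; yes; no; contradiction)
open import Relation.Binary.Definitions using (DecidableEquality)
open import Relation.Binary.PropositionalEquality
  using (_≡_; _≢_; refl; sym; trans; cong; cong₂; subst; module ≡-Reasoning)
open import Data.Empty using (⊥)
open import Function using (_∘_)

module Multiplicity {a} {A : Set a} (_≟_ : DecidableEquality A) where

  indicator : ∀ {p} {P : Set p} → Dec P → ℕ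
  indicator (yes _) = 1
  indicator (no  _) = 0

  count : A → List A → ℕ
  count x []       = 0
  count x (y ∷ ys) = indicator (x ≟ y) + count x ys

  ∈⇒count>0 : ∀ {x xs} → x ∈ xs → 0 < count x xs
  ∈⇒count>0 {x} (here refl) with x ≟ x
  ... | yes _   = z<s
  ... | no  x≢x = contradiction refl x≢x
  ∈⇒count>0 {x} {y ∷ _} (there x∈ys) with x ≟ y
  ... | yes _ = z<s
  ... | no  _ = ∈⇒count>0 x∈ys

  count>0⇒∈ : ∀ {x xs} → 0 < count x xs → x ∈ xs
  count>0⇒∈ {x} {y ∷ _} pos with x ≟ y
  ... | yes refl = here refl
  ... | no  _    = there (count>0⇒∈ pos)

  ∉⇒count≡0 : ∀ {x xs} → x ∉ xs → count x xs ≡ 0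
  ∉⇒count≡0 x∉xs = n≤0⇒n≡0 (≮⇒≥ (λ pos → x∉xs (count>0⇒∈ pos)))

  count-resp-↭ : ∀ {x xs ys} → xs ↭ ys → count x xs ≡ count x ys
  count-resp-↭ ↭-refl = refl
  count-resp-↭ {x} (prep y p) with x ≟ y
  ... | yes _ = cong suc (count-resp-↭ p)
  ... | no  _ = count-resp-↭ p
  count-resp-↭ {x} (swap y z p) with x ≟ y | x ≟ z
  ... | yes _ | yes _ = cong (λ k → suc (suc k)) (count-resp-↭ p)
  ... | yes _ | no  _ = cong suc (count-resp-↭ p)
  ... | no  _ | yes _ = cong suc (count-resp-↭ p)
  ... | no  _ | no  _ = count-resp-↭ p
  count-resp-↭ (↭-trans p q) = trans (count-resp-↭ p) (count-resp-↭ q)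

  count-∷-cancel : ∀ {x} y {xs ys} →
                   count x (y ∷ xs) ≡ count x (y ∷ ys) → count x xs ≡ count x ys
  count-∷-cancel {x} y eq with x ≟ y
  ... | yes _ = suc-injective eq
  ... | no  _ = eq

  ↭-from-counts : ∀ xs ys → (∀ x → count x xs ≡ count x ys) → xs ↭ ys
  ↭-from-counts [] [] _ = ↭-refl
  ↭-from-counts [] (y ∷ ys) same =
    contradiction (same y) (<⇒≢ (∈⇒count>0 {y} {y ∷ ys} (here refl)))
  ↭-from-counts (x ∷ xs) ys same
    with ys₁ , ys₂ , refl ← ∈-∃++ {v = x} {xs = ys}
                               (count>0⇒∈ (subst (0 <_) (same x)
                                 (∈⇒count>0 {x} {x ∷ xs} (here refl))))
    = ↭-trans (prep x (↭-from-counts xs (ys₁ ++ ys₂) same-rest))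
              (↭-sym (shift x ys₁ ys₂))
    where
    same-rest : ∀ z → count z xs ≡ count z (ys₁ ++ ys₂)
    same-rest z = count-∷-cancel x {xs} {ys₁ ++ ys₂}
                    (trans (same z) (count-resp-↭ (shift x ys₁ ys₂)))

  count-pair-≤ : ∀ {x y} → x ≢ y → ∀ zs → count x zs + count y zs ≤ length zs
  count-pair-≤ x≢y [] = z≤n
  count-pair-≤ {x} {y} x≢y (z ∷ zs) with x ≟ z | y ≟ z
  ... | yes refl | yes refl = contradiction refl x≢y
  ... | yes _    | no  _    = s≤s (count-pair-≤ x≢y zs)
  ... | no  _    | yes _    = subst (_≤ suc (length zs))
                                (sym (+-suc (count x zs) (count y zs)))
                                (s≤s (count-pair-≤ x≢y zs))
  ... | no  _    | no  _    = m≤n⇒m≤1+n (count-pair-≤ x≢y zs)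

  count-pair-< : ∀ {x y w} → x ≢ y → w ≢ x → w ≢ y →
                 ∀ zs → w ∈ zs → count x zs + count y zs < length zs
  count-pair-< {x} {y} x≢y w≢x w≢y (z ∷ zs) (here refl) with x ≟ z | y ≟ z
  ... | yes refl | _        = contradiction refl w≢x
  ... | no  _    | yes refl = contradiction refl w≢y
  ... | no  _    | no  _    = s≤s (count-pair-≤ x≢y zs)
  count-pair-< {x} {y} x≢y w≢x w≢y (z ∷ zs) (there w∈zs) with x ≟ z | y ≟ z
  ... | yes refl | yes refl = contradiction refl x≢y
  ... | yes _    | no  _    = s≤s (count-pair-< x≢y w≢x w≢y zs w∈zs)
  ... | no  _    | yes _    = subst (_< suc (length zs))
                                (sym (+-suc (count x zs) (count y zs)))
                                (s≤s (count-pair-< x≢y w≢x w≢y zs w∈zs))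
  ... | no  _    | no  _    = m≤n⇒m≤1+n (count-pair-< x≢y w≢x w≢y zs w∈zs)

  count-map-unique : ∀ {b} {B : Set b} (f : B → A) {x u} {W : List B} →
                     Unique W → u ∈ W → f u ≡ x →
                     (∀ {w} → w ∈ W → f w ≡ x → w ≡ u) →
                     count x (map f W) ≡ 1
  count-map-unique f {x} {W = w ∷ ws} (w∉ws ∷ _) (here refl) fu≡x only
    with x ≟ f w
  ... | yes _   = cong suc (∉⇒count≡0 x∉image)
    where
    x∉image : x ∉ map f ws
    x∉image x∈image with v , v∈ws , x≡fv ← ∈-map⁻ f x∈image =
      All.lookup w∉ws v∈ws (sym (only (there v∈ws) (sym x≡fv)))
  ... | no  x≢fw = contradiction (sym fu≡x) x≢fw
  count-map-unique f {x} {W = w ∷ ws} (w∉ws ∷ uniq) (there u∈ws) fu≡x only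
    with x ≟ f w
  ... | yes x≡fw = contradiction (only (here refl) (sym x≡fw))
                                 (All.lookup w∉ws u∈ws)
  ... | no  _    = count-map-unique f uniq u∈ws fu≡x (λ v∈ws → only (there v∈ws))

open Multiplicity Data.Nat._≟_

count-012 : ∀ zs → All (_≤ 2) zs → count 0 zs + count 1 zs + count 2 zs ≡ length zs
count-012 [] All.[] = refl
count-012 (0 ∷ zs) (_ All.∷ bd) = cong suc (count-012 zs bd)
count-012 (1 ∷ zs) (_ All.∷ bd) = begin
  count 0 zs + suc (count 1 zs) + count 2 zs ≡⟨ cong (_+ count 2 zs) (+-suc (count 0 zs) _) ⟩
  suc (count 0 zs + count 1 zs + count 2 zs) ≡⟨ cong suc (count-012 zs bd) ⟩
  suc (length zs)                            ∎
  where open ≡-Reasoning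
count-012 (2 ∷ zs) (_ All.∷ bd) = begin
  count 0 zs + count 1 zs + suc (count 2 zs) ≡⟨ +-suc (count 0 zs + count 1 zs) _ ⟩
  suc (count 0 zs + count 1 zs + count 2 zs) ≡⟨ cong suc (count-012 zs bd) ⟩
  suc (length zs)                            ∎
  where open ≡-Reasoning
count-012 (suc (suc (suc _)) ∷ _) (s≤s (s≤s ()) All.∷ _)

pigeonhole-window : ∀ {n} (g : Fin n → ℕ) (lo m : ℕ) → m < n →
                    (∀ i → lo ≤ g i × g i < lo + m) →
                    ∃₂ λ i j → i ≢ j × g i ≡ g j
pigeonhole-window {n} g lo m m<n window = collide (FinP.pigeonhole m<n shifted)
  where
  open ≡-Reasoning
  offset<m : ∀ i → g i ∸ lo < m
  offset<m i = +-cancelˡ-< lo (g i ∸ lo) m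
    (subst (_< lo + m) (sym (m+[n∸m]≡n (proj₁ (window i)))) (proj₂ (window i)))
  shifted : Fin n → Fin m
  shifted i = fromℕ< (offset<m i)
  collide : (∃₂ λ i j → i F.< j × shifted i ≡ shifted j) →
            ∃₂ λ i j → i ≢ j × g i ≡ g j
  collide (i , j , i<j , same) =
    i , j , FinP.<⇒≢ i<j ,
    ∸-cancelʳ-≡ (proj₁ (window i)) (proj₁ (window j)) (begin
      g i ∸ lo          ≡⟨ sym (FinP.toℕ-fromℕ< (offset<m i)) ⟩
      toℕ (shifted i)   ≡⟨ cong toℕ same ⟩
      toℕ (shifted j)   ≡⟨ FinP.toℕ-fromℕ< (offset<m j) ⟩
      g j ∸ lo          ∎)

pigeonhole-gap : ∀ {m} (g : Fin (suc m) → ℕ) → (∀ i → g i ≤ m) →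
                 (∀ i j → g i ≡ 0 → g j ≢ m) →
                 ∃₂ λ i j → i ≢ j × g i ≡ g j
pigeonhole-gap {m} g bounded gap with FinP.any? (λ i → g i Data.Nat.≟ 0)
... | yes (i₀ , gi₀≡0) = pigeonhole-window g 0 m ≤-refl
        (λ j → z≤n , ≤∧≢⇒< (bounded j) (gap i₀ j gi₀≡0))
... | no  never-0      = pigeonhole-window g 1 m ≤-refl
        (λ j → n≢0⇒n>0 (λ gj≡0 → never-0 (j , gj≡0)) , s≤s (bounded j))

lookup-injective : ∀ {a} {A : Set a} {xs : List A} → Unique xs →
                   ∀ i j → lookup xs i ≡ lookup xs j → i ≡ j
lookup-injective [] () _ _
lookup-injective (_ ∷ _) F.zero F.zero _ = refl
lookup-injective (x∉xs ∷ _) F.zero (F.suc j) eq =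
  contradiction eq (All.lookup x∉xs (∈-lookup j))
lookup-injective (x∉xs ∷ _) (F.suc i) F.zero eq =
  contradiction (sym eq) (All.lookup x∉xs (∈-lookup i))
lookup-injective (_ ∷ uniq) (F.suc i) (F.suc j) eq =
  cong F.suc (lookup-injective uniq i j eq)

module Distance {n} {G : SimpleGraph n} {d : Fin n → Fin n → ℕ}
                (isDist : IsDistanceFn G d) where

  dist-self : ∀ x → d x x ≡ 0
  dist-self x = n≤0⇒n≡0 (proj₂ (isDist x x) 0 stay)

  dist-zero⇒≡ : ∀ {x y} → d x y ≡ 0 → x ≡ y
  dist-zero⇒≡ {x} {y} dxy≡0 with subst (Walk G x y) dxy≡0 (proj₁ (isDist x y))
  ... | stay = refl

  -- Distance 1 means adjacency, which is symmetric.
  dist-one-sym : ∀ {x y} → d x y ≡ 1 → d y x ≡ 1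
  dist-one-sym {x} {y} dxy≡1
    with subst (Walk G x y) dxy≡1 (proj₁ (isDist x y))
  ... | step adj stay = ≤-antisym (proj₂ (isDist y x) 1 (step (SimpleGraph.sym G adj) stay))
                                  (n≢0⇒n>0 dyx≢0)
    where
    dyx≢0 : d y x ≢ 0
    dyx≢0 dyx≡0 with dist-zero⇒≡ dyx≡0
    ... | refl = contradiction (trans (sym dxy≡1) (dist-self x)) (λ ())

module Representations {n} {G : SimpleGraph n} {d : Fin n → Fin n → ℕ}
         (isDist : IsDistanceFn G d) (W : List (Fin n)) (uniq : Unique W)
         (close : ∀ x y → x ∈ W → y ∈ W → d x y ≤ 2)
         {m : ℕ} (size : length W ≡ suc m) (1≤m : 1 ≤ m) where

  open Distance isDist

  length-rm : ∀ x → length (rm d x W) ≡ suc m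
  length-rm x = trans (length-map (d x) W) size

  -- x itself is the only vertex of W at distance 0 from x.
  zeros : ∀ {x} → x ∈ W → count 0 (rm d x W) ≡ 1
  zeros {x} x∈W = count-map-unique (d x) uniq x∈W (dist-self x)
                    (λ _ dxw≡0 → sym (dist-zero⇒≡ dxw≡0))

  degree : Fin n → ℕ
  degree x = count 1 (rm d x W)

  degree-≤ : ∀ {x} → x ∈ W → degree x ≤ m
  degree-≤ {x} x∈W = s≤s⁻¹ (begin
    suc (degree x)                          ≡⟨ cong (_+ degree x) (sym (zeros x∈W)) ⟩
    count 0 (rm d x W) + degree x           ≤⟨ count-pair-≤ (λ ()) (rm d x W) ⟩
    length (rm d x W)                       ≡⟨ length-rm x ⟩
    suc m                                   ∎)
    where open ≤-Reasoning

  -- If y has W-degree m, its representation consists of one 0 and m 1s, so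
  -- every other vertex x of W is adjacent to y and has W-degree at least 1.
  -- (When x = y, the two degrees 0 and m ≥ 1 clash directly.)
  degree-gap : ∀ {x y} → x ∈ W → y ∈ W → degree x ≡ 0 → degree y ≢ m
  degree-gap {x} {y} x∈W y∈W deg-x≡0 deg-y≡m
    with d y x Data.Nat.≟ 0 | d y x Data.Nat.≟ 1
  ... | yes dyx≡0 | _ with dist-zero⇒≡ dyx≡0
  ...   | refl = contradiction (trans (sym deg-x≡0) deg-y≡m) (<⇒≢ 1≤m)
  degree-gap {x} {y} x∈W y∈W deg-x≡0 deg-y≡m | no _ | yes dyx≡1 =
    contradiction (sym deg-x≡0) (<⇒≢ (∈⇒count>0 one∈rm))
    where
    one∈rm : 1 ∈ rm d x W
    one∈rm = subst (_∈ rm d x W) (dist-one-sym dyx≡1) (∈-map⁺ (d x) y∈W)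
  degree-gap {x} {y} x∈W y∈W deg-x≡0 deg-y≡m | no dyx≢0 | no dyx≢1 =
    <-irrefl refl (begin-strict
      suc m                                   ≡⟨ cong₂ _+_ (sym (zeros y∈W)) (sym deg-y≡m) ⟩
      count 0 (rm d y W) + degree y           <⟨ count-pair-< (λ ()) dyx≢0 dyx≢1
                                                   (rm d y W) (∈-map⁺ (d y) x∈W) ⟩
      length (rm d y W)                       ≡⟨ length-rm y ⟩
      suc m                                   ∎)
    where open ≤-Reasoning

  bounded : ∀ {x} → x ∈ W → All (_≤ 2) (rm d x W)
  bounded x∈W = AllP.map⁺ (All.tabulate (λ w∈W → close _ _ x∈W w∈W))

  -- Vertices of W with equal W-degree have equal representations: the
  -- multiplicities of 0 and 1 agree, that of 2 is what remains of the length,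
  -- and larger values do not occur.
  same-degree⇒same-rm : ∀ {x y} → x ∈ W → y ∈ W → degree x ≡ degree y →
                        rm d x W ↭ rm d y W
  same-degree⇒same-rm {x} {y} x∈W y∈W deg≡ = ↭-from-counts _ _ same-count
    where
    same-zeros : count 0 (rm d x W) ≡ count 0 (rm d y W)
    same-zeros = trans (zeros x∈W) (sym (zeros y∈W))
    same-count : ∀ k → count k (rm d x W) ≡ count k (rm d y W)
    same-count 0 = same-zeros
    same-count 1 = deg≡
    same-count 2 = +-cancelˡ-≡ (count 0 (rm d x W) + degree x) _ _ (begin
      count 0 (rm d x W) + degree x + count 2 (rm d x W) ≡⟨ count-012 _ (bounded x∈W) ⟩
      length (rm d x W)                                  ≡⟨ length-rm x ⟩
      suc m                                              ≡⟨ sym (length-rm y) ⟩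
      length (rm d y W)                                  ≡⟨ sym (count-012 _ (bounded y∈W)) ⟩
      count 0 (rm d y W) + degree y + count 2 (rm d y W) ≡⟨ cong (_+ count 2 (rm d y W))
                                                             (cong₂ _+_ (sym same-zeros) (sym deg≡)) ⟩
      count 0 (rm d x W) + degree x + count 2 (rm d y W) ∎)
      where open ≡-Reasoning
    same-count (suc (suc (suc k))) = trans (absent x∈W) (sym (absent y∈W))
      where
      absent : ∀ {v} → v ∈ W → count (3 + k) (rm d v W) ≡ 0
      absent v∈W = ∉⇒count≡0 (λ k∈rm → contradiction (All.lookup (bounded v∈W) k∈rm)
                                                      (λ { (s≤s (s≤s ())) }))

lemma3p1 : ∀ {n} (G : SimpleGraph n) → Connected G
    → (d : Fin n → Fin n → ℕ) → IsDistanceFn G d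
    → (W : List (Fin n)) → Unique W → 2 ≤ length W
    → (∀ x y → x ∈ W → y ∈ W → d x y ≤ 2)
    → ¬ MResolving d W
lemma3p1 G _ d isDist (w ∷ ws) uniq (s≤s 1≤m) close resolving =
  conclude (pigeonhole-gap (degree ∘ lookup W) (degree-≤ ∘ ∈-lookup)
                           (λ i j → degree-gap (∈-lookup i) (∈-lookup j)))
  where
  W : List (Fin _)
  W = w ∷ ws
  open Representations isDist W uniq close refl 1≤m
  conclude : (∃₂ λ i j → i ≢ j × degree (lookup W i) ≡ degree (lookup W j)) → ⊥
  conclude (i , j , i≢j , deg≡) =
    resolving (lookup W i) (lookup W j) (i≢j ∘ lookup-injective uniq i j)
              (same-degree⇒same-rm (∈-lookup i) (∈-lookup j) deg≡)
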